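{- Let $G$ be a finite simple graph and let $S,T\in\Psi(G)$. Then $S\cup (T\setminus N[S])\in\Psi(G)$ and $T\cup(S\setminus N[T])\in\Psi(G)$.
   Context: For a graph $G$ and $X\subseteq V(G)$, $N(X)$ is the set of vertices adjacent to some vertex of $X$ and $N[X]=X\cup N(X)$; $G[X]$ is the induced subgraph on $X$. A set $S\subseteq V(G)$ is a local maximum independent set of $G$ if $S$ is a maximum independent set of $G[N[S]]$; $\Psi(G)$ denotes the family of all local maximum independent sets of $G$. -}

module Defs where

open import Data.Nat using (ℕ; _≤_)
open import Data.Bool using (Bool; true; false; _∨_; _∧_)
open import Data.Fin using (Fin)
open import Data.Fin.Subset using (Subset; _∈_; _⊆_; ∣_∣; _∪_; _─_)
open import Data.Vec using (tabulate; lookup)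
open import Data.List using (allFin)
open import Data.Bool.ListAction using () renaming (any to anyL)
open import Data.Product using (_×_)
open import Relation.Binary.PropositionalEquality using (_≡_)

record Graph (n : ℕ) : Set where
  field
    adj   : Fin n → Fin n → Bool
    irrefl : ∀ x → adj x x ≡ false
    sym   : ∀ x y → adj x y ≡ adj y x
open Graph public

module _ {n : ℕ} (G : Graph n) where

  adjToSome : Subset n → Fin n → Bool
  adjToSome X y = anyL (λ x → lookup X x ∧ adj G x y) (allFin n)

  N : Subset n → Subset n
  N X = tabulate (adjToSome X)

  N[_] : Subset n → Subset n
  N[ X ] = X ∪ N X

  Independent : Subset n → Set
  Independent S = ∀ x y → x ∈ S → y ∈ S → adj G x y ≡ false

  -- S is a maximum independent set of the induced subgraph G[A]
  -- (independent sets of G[A] are exactly the independent sets of G contained in A)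
  MaxIndependentIn : Subset n → Subset n → Set
  MaxIndependentIn A S =
    S ⊆ A × Independent S × (∀ I → I ⊆ A → Independent I → ∣ I ∣ ≤ ∣ S ∣)

  Ψ : Subset n → Set
  Ψ S = MaxIndependentIn N[ S ] S

{-# OPTIONS --safe #-}

-- With X = T ─ N[S], the set U = S ∪ X is independent because X avoids N[S].  An
-- independent I ⊆ N[U] splits along N[S].  The part inside N[S] has at most ∣S∣
-- elements as S ∈ Ψ.  The part P outside N[S] lies in N[X] ⊆ N[T] and has no
-- neighbour in S, so P ∪ (S ∩ N[T]) is independent in N[T] and T ∈ Ψ gives
-- ∣P∣ + ∣S ∩ N[T]∣ ≤ ∣T∣ = ∣T ∩ N[S]∣ + ∣X∣.  Exchanging roles,
-- (T ∩ N[S]) ∪ (S ─ N[T]) is independent in N[S], whence ∣T ∩ N[S]∣ ≤ ∣S ∩ N[T]∣.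
-- So ∣P∣ ≤ ∣X∣ and ∣I∣ ≤ ∣S∣ + ∣X∣ = ∣U∣.

module Submission where

open import Defs hiding (sym)
open import Data.Nat using (ℕ; suc; _+_; _≤_)
open import Data.Nat.Properties using (+-suc; +-identityʳ; +-comm; +-monoˡ-≤; +-mono-≤; +-cancelʳ-≤; module ≤-Reasoning)
open import Data.Fin.Subset using (Subset; inside; outside; _∈_; _∉_; _⊆_; ∣_∣; _∪_; _∩_; _─_; Empty)
open import Data.Fin.Subset.Properties using (x∈p∪q⁺; x∈p∪q⁻; x∈p∩q⁻; p∩q⊆p; p∩q⊆q; p⊆p∪q; q⊆p∪q; p─q⊆p; x∈p∧x∉q⇒x∈p─q; Empty-unique; ∣⊥∣≡0)
open import Data.Vec using ([]; _∷_; there; lookup)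
open import Data.Vec.Properties using (lookup∘tabulate; []=⇒lookup; lookup⇒[]=)
open import Data.List using (allFin)
open import Data.List.Membership.Propositional.Properties using (∈-allFin)
open import Data.List.Relation.Unary.Any as Any using (satisfied)
open import Data.List.Relation.Unary.Any.Properties using (any⁺; any⁻)
open import Data.Bool using (true; false; _∧_; T)
open import Data.Bool.Properties using (T-≡; T-∧)
open import Data.Product using (_×_; _,_; ∃-syntax)
open import Data.Sum as Sum using (inj₁; inj₂)
open import Data.Empty using (⊥-elim)
open import Function using (Equivalence)
open import Relation.Binary.PropositionalEquality using (_≡_; refl; sym; trans; cong; module ≡-Reasoning)

private
  variable
    n : ℕ

x∈p─q⇒x∉q : ∀ (p q : Subset n) {x} → x ∈ p ─ q → x ∉ q
x∈p─q⇒x∉q (_ ∷ p) (inside  ∷ q) (there x∈p─q) (there x∈q) = x∈p─q⇒x∉q p q x∈p─q x∈q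
x∈p─q⇒x∉q (_ ∷ p) (outside ∷ q) (there x∈p─q) (there x∈q) = x∈p─q⇒x∉q p q x∈p─q x∈q

∣p∩q∣+∣p─q∣≡∣p∣ : ∀ (p q : Subset n) → ∣ p ∩ q ∣ + ∣ p ─ q ∣ ≡ ∣ p ∣
∣p∩q∣+∣p─q∣≡∣p∣ []             []             = refl
∣p∩q∣+∣p─q∣≡∣p∣ (inside  ∷ p) (inside  ∷ q) = cong suc (∣p∩q∣+∣p─q∣≡∣p∣ p q)
∣p∩q∣+∣p─q∣≡∣p∣ (inside  ∷ p) (outside ∷ q) = trans (+-suc _ _) (cong suc (∣p∩q∣+∣p─q∣≡∣p∣ p q))
∣p∩q∣+∣p─q∣≡∣p∣ (outside ∷ p) (inside  ∷ q) = ∣p∩q∣+∣p─q∣≡∣p∣ p q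
∣p∩q∣+∣p─q∣≡∣p∣ (outside ∷ p) (outside ∷ q) = ∣p∩q∣+∣p─q∣≡∣p∣ p q

∣p∪q∣+∣p∩q∣≡∣p∣+∣q∣ : ∀ (p q : Subset n) → ∣ p ∪ q ∣ + ∣ p ∩ q ∣ ≡ ∣ p ∣ + ∣ q ∣
∣p∪q∣+∣p∩q∣≡∣p∣+∣q∣ []             []             = refl
∣p∪q∣+∣p∩q∣≡∣p∣+∣q∣ (inside  ∷ p) (inside  ∷ q) =
  cong suc (trans (+-suc _ _) (trans (cong suc (∣p∪q∣+∣p∩q∣≡∣p∣+∣q∣ p q)) (sym (+-suc _ _))))
∣p∪q∣+∣p∩q∣≡∣p∣+∣q∣ (inside  ∷ p) (outside ∷ q) = cong suc (∣p∪q∣+∣p∩q∣≡∣p∣+∣q∣ p q)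
∣p∪q∣+∣p∩q∣≡∣p∣+∣q∣ (outside ∷ p) (inside  ∷ q) =
  trans (cong suc (∣p∪q∣+∣p∩q∣≡∣p∣+∣q∣ p q)) (sym (+-suc _ _))
∣p∪q∣+∣p∩q∣≡∣p∣+∣q∣ (outside ∷ p) (outside ∷ q) = ∣p∪q∣+∣p∩q∣≡∣p∣+∣q∣ p q

∣p∪q∣≡∣p∣+∣q∣ : ∀ (p q : Subset n) → Empty (p ∩ q) → ∣ p ∪ q ∣ ≡ ∣ p ∣ + ∣ q ∣
∣p∪q∣≡∣p∣+∣q∣ {n} p q p∩q-empty = begin
  ∣ p ∪ q ∣              ≡⟨ sym (+-identityʳ _) ⟩
  ∣ p ∪ q ∣ + 0          ≡⟨ cong (∣ p ∪ q ∣ +_) (sym ∣p∩q∣≡0) ⟩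
  ∣ p ∪ q ∣ + ∣ p ∩ q ∣  ≡⟨ ∣p∪q∣+∣p∩q∣≡∣p∣+∣q∣ p q ⟩
  ∣ p ∣ + ∣ q ∣          ∎
  where
  open ≡-Reasoning
  ∣p∩q∣≡0 : ∣ p ∩ q ∣ ≡ 0
  ∣p∩q∣≡0 = trans (cong ∣_∣ (Empty-unique p∩q-empty)) (∣⊥∣≡0 n)

module _ (G : Graph n) where

  ∈N⁺ : ∀ {X x y} → x ∈ X → adj G x y ≡ true → y ∈ N G X
  ∈N⁺ {X} {x} {y} x∈X x~y = lookup⇒[]= y (N G X) (begin
    lookup (N G X) y  ≡⟨ lookup∘tabulate (adjToSome G X) y ⟩
    adjToSome G X y   ≡⟨ Equivalence.to T-≡ (any⁺ _ (Any.map (λ { refl → x∈X×x~y }) (∈-allFin x))) ⟩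
    true              ∎)
    where
    open ≡-Reasoning
    x∈X×x~y : T (lookup X x ∧ adj G x y)
    x∈X×x~y = Equivalence.from T-∧ (Equivalence.from T-≡ ([]=⇒lookup x∈X) , Equivalence.from T-≡ x~y)

  ∈N⁻ : ∀ {X y} → y ∈ N G X → ∃[ x ] x ∈ X × adj G x y ≡ true
  ∈N⁻ {X} {y} y∈NX =
    let x , x∈X×x~y = satisfied (any⁻ _ (allFin _) (Equivalence.from T-≡ adjToSome≡true))
        x∈X , x~y   = Equivalence.to T-∧ x∈X×x~y
    in  x , lookup⇒[]= x X (Equivalence.to T-≡ x∈X) , Equivalence.to T-≡ x~y
    where
    adjToSome≡true : adjToSome G X y ≡ true
    adjToSome≡true = trans (sym (lookup∘tabulate (adjToSome G X) y)) ([]=⇒lookup y∈NX)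

  N[]-mono : ∀ {A B} → A ⊆ B → N[_] G A ⊆ N[_] G B
  N[]-mono {A} {B} A⊆B y∈N[A] with x∈p∪q⁻ A (N G A) y∈N[A]
  ... | inj₁ y∈A = p⊆p∪q (N G B) (A⊆B y∈A)
  ... | inj₂ y∈NA with ∈N⁻ y∈NA
  ...   | x , x∈A , x~y = q⊆p∪q B (N G B) (∈N⁺ (A⊆B x∈A) x~y)

  N[∪]⊆N[]∪N[] : ∀ A B → N[_] G (A ∪ B) ⊆ N[_] G A ∪ N[_] G B
  N[∪]⊆N[]∪N[] A B y∈N[A∪B] with x∈p∪q⁻ (A ∪ B) (N G (A ∪ B)) y∈N[A∪B]
  ... | inj₁ y∈A∪B = x∈p∪q⁺ (Sum.map (p⊆p∪q (N G A)) (p⊆p∪q (N G B)) (x∈p∪q⁻ A B y∈A∪B))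
  ... | inj₂ y∈N[A∪B] with ∈N⁻ y∈N[A∪B]
  ...   | x , x∈A∪B , x~y =
    x∈p∪q⁺ (Sum.map (λ x∈A → q⊆p∪q A (N G A) (∈N⁺ x∈A x~y))
                    (λ x∈B → q⊆p∪q B (N G B) (∈N⁺ x∈B x~y))
                    (x∈p∪q⁻ A B x∈A∪B))

  ∉N[]⇒¬adj : ∀ {X x y} → x ∈ X → y ∉ N[_] G X → adj G x y ≡ false
  ∉N[]⇒¬adj {X} {x} {y} x∈X y∉N[X] with adj G x y in x~y
  ... | true  = ⊥-elim (y∉N[X] (q⊆p∪q X (N G X) (∈N⁺ x∈X x~y)))
  ... | false = refl

  Independent-⊆ : ∀ {A B} → A ⊆ B → Independent G B → Independent G A
  Independent-⊆ A⊆B indB x y x∈A y∈A = indB x y (A⊆B x∈A) (A⊆B y∈A)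

  Independent-∪ : ∀ {A B} → Independent G A → Independent G B →
                  (∀ {a b} → a ∈ A → b ∈ B → adj G a b ≡ false) →
                  Independent G (A ∪ B)
  Independent-∪ {A} {B} indA indB A≁B x y x∈A∪B y∈A∪B
    with x∈p∪q⁻ A B x∈A∪B | x∈p∪q⁻ A B y∈A∪B
  ... | inj₁ x∈A | inj₁ y∈A = indA x y x∈A y∈A
  ... | inj₁ x∈A | inj₂ y∈B = A≁B x∈A y∈B
  ... | inj₂ x∈B | inj₁ y∈A = trans (Graph.sym G x y) (A≁B y∈A x∈B)
  ... | inj₂ x∈B | inj₂ y∈B = indB x y x∈B y∈B

  ∣T∩N[S]∣≤∣S∩N[T]∣ : ∀ {S T} → Ψ G S → Independent G T →
                      ∣ T ∩ N[_] G S ∣ ≤ ∣ S ∩ N[_] G T ∣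
  ∣T∩N[S]∣≤∣S∩N[T]∣ {S} {T} (_ , indS , maxS) indT = +-cancelʳ-≤ ∣ S ─ N[T] ∣ _ _ (begin
    ∣ T ∩ N[S] ∣ + ∣ S ─ N[T] ∣  ≡⟨ sym (∣p∪q∣≡∣p∣+∣q∣ (T ∩ N[S]) (S ─ N[T]) disjoint) ⟩
    ∣ A ∣                        ≤⟨ maxS A A⊆N[S] indA ⟩
    ∣ S ∣                        ≡⟨ sym (∣p∩q∣+∣p─q∣≡∣p∣ S N[T]) ⟩
    ∣ S ∩ N[T] ∣ + ∣ S ─ N[T] ∣  ∎)
    where
    open ≤-Reasoning
    N[S] N[T] A : Subset n
    N[S] = N[_] G S
    N[T] = N[_] G T
    A = (T ∩ N[S]) ∪ (S ─ N[T])
    disjoint : Empty ((T ∩ N[S]) ∩ (S ─ N[T]))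
    disjoint (x , x∈A∩B) with x∈p∩q⁻ (T ∩ N[S]) (S ─ N[T]) x∈A∩B
    ... | x∈T∩N[S] , x∈S─N[T] =
      x∈p─q⇒x∉q S N[T] x∈S─N[T] (p⊆p∪q (N G T) (p∩q⊆p T N[S] x∈T∩N[S]))
    A⊆N[S] : A ⊆ N[S]
    A⊆N[S] x∈A with x∈p∪q⁻ (T ∩ N[S]) (S ─ N[T]) x∈A
    ... | inj₁ x∈T∩N[S] = p∩q⊆q T N[S] x∈T∩N[S]
    ... | inj₂ x∈S─N[T] = p⊆p∪q (N G S) (p─q⊆p S N[T] x∈S─N[T])
    indA : Independent G A
    indA = Independent-∪ (Independent-⊆ (p∩q⊆p T N[S]) indT) (Independent-⊆ (p─q⊆p S N[T]) indS)
      (λ a∈T∩N[S] b∈S─N[T] → ∉N[]⇒¬adj (p∩q⊆p T N[S] a∈T∩N[S]) (x∈p─q⇒x∉q S N[T] b∈S─N[T]))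

  ∣P∣≤∣T─N[S]∣ : ∀ {S T P} → Ψ G S → Ψ G T → P ⊆ N[_] G T ─ N[_] G S → Independent G P →
                 ∣ P ∣ ≤ ∣ T ─ N[_] G S ∣
  ∣P∣≤∣T─N[S]∣ {S} {T} {P} ψS@(_ , indS , _) (_ , indT , maxT) P⊆N[T]─N[S] indP =
    +-cancelʳ-≤ ∣ S ∩ N[T] ∣ _ _ (begin
      ∣ P ∣ + ∣ S ∩ N[T] ∣         ≡⟨ sym (∣p∪q∣≡∣p∣+∣q∣ P (S ∩ N[T]) disjoint) ⟩
      ∣ Y ∣                        ≤⟨ maxT Y Y⊆N[T] indY ⟩
      ∣ T ∣                        ≡⟨ sym (∣p∩q∣+∣p─q∣≡∣p∣ T N[S]) ⟩
      ∣ T ∩ N[S] ∣ + ∣ T ─ N[S] ∣  ≤⟨ +-monoˡ-≤ ∣ T ─ N[S] ∣ (∣T∩N[S]∣≤∣S∩N[T]∣ ψS indT) ⟩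
      ∣ S ∩ N[T] ∣ + ∣ T ─ N[S] ∣  ≡⟨ +-comm ∣ S ∩ N[T] ∣ _ ⟩
      ∣ T ─ N[S] ∣ + ∣ S ∩ N[T] ∣  ∎)
    where
    open ≤-Reasoning
    N[S] N[T] Y : Subset n
    N[S] = N[_] G S
    N[T] = N[_] G T
    Y = P ∪ (S ∩ N[T])
    P∌N[S] : ∀ {x} → x ∈ P → x ∉ N[S]
    P∌N[S] x∈P = x∈p─q⇒x∉q N[T] N[S] (P⊆N[T]─N[S] x∈P)
    disjoint : Empty (P ∩ (S ∩ N[T]))
    disjoint (x , x∈P∩S∩N[T]) with x∈p∩q⁻ P (S ∩ N[T]) x∈P∩S∩N[T]
    ... | x∈P , x∈S∩N[T] = P∌N[S] x∈P (p⊆p∪q (N G S) (p∩q⊆p S N[T] x∈S∩N[T]))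
    Y⊆N[T] : Y ⊆ N[T]
    Y⊆N[T] x∈Y with x∈p∪q⁻ P (S ∩ N[T]) x∈Y
    ... | inj₁ x∈P       = p─q⊆p N[T] N[S] (P⊆N[T]─N[S] x∈P)
    ... | inj₂ x∈S∩N[T] = p∩q⊆q S N[T] x∈S∩N[T]
    indY : Independent G Y
    indY = Independent-∪ indP (Independent-⊆ (p∩q⊆p S N[T]) indS)
      (λ a∈P b∈S∩N[T] → trans (Graph.sym G _ _) (∉N[]⇒¬adj (p∩q⊆p S N[T] b∈S∩N[T]) (P∌N[S] a∈P)))

  S∪[T─N[S]]∈Ψ : ∀ {S T} → Ψ G S → Ψ G T → Ψ G (S ∪ (T ─ N[_] G S))
  S∪[T─N[S]]∈Ψ {S} {T} ψS@(_ , indS , maxS) ψT@(_ , indT , _) = U⊆N[U] , indU , maxU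
    where
    N[S] X U : Subset n
    N[S] = N[_] G S
    X = T ─ N[S]
    U = S ∪ X
    U⊆N[U] : U ⊆ N[_] G U
    U⊆N[U] = p⊆p∪q (N G U)
    X∌N[S] : ∀ {x} → x ∈ X → x ∉ N[S]
    X∌N[S] = x∈p─q⇒x∉q T N[S]
    indU : Independent G U
    indU = Independent-∪ indS (Independent-⊆ (p─q⊆p T N[S]) indT)
      (λ a∈S b∈X → ∉N[]⇒¬adj a∈S (X∌N[S] b∈X))
    disjoint : Empty (S ∩ X)
    disjoint (x , x∈S∩X) with x∈p∩q⁻ S X x∈S∩X
    ... | x∈S , x∈X = X∌N[S] x∈X (p⊆p∪q (N G S) x∈S)
    I─N[S]⊆N[T]─N[S] : ∀ {I} → I ⊆ N[_] G U → I ─ N[S] ⊆ N[_] G T ─ N[S]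
    I─N[S]⊆N[T]─N[S] {I} I⊆N[U] x∈I─N[S]
      with x∈p∪q⁻ N[S] (N[_] G X) (N[∪]⊆N[]∪N[] S X (I⊆N[U] (p─q⊆p I N[S] x∈I─N[S])))
    ... | inj₁ x∈N[S] = ⊥-elim (x∈p─q⇒x∉q I N[S] x∈I─N[S] x∈N[S])
    ... | inj₂ x∈N[X] = x∈p∧x∉q⇒x∈p─q (N[]-mono (p─q⊆p T N[S]) x∈N[X]) (x∈p─q⇒x∉q I N[S] x∈I─N[S])
    maxU : ∀ I → I ⊆ N[_] G U → Independent G I → ∣ I ∣ ≤ ∣ U ∣
    maxU I I⊆N[U] indI = begin
      ∣ I ∣                        ≡⟨ sym (∣p∩q∣+∣p─q∣≡∣p∣ I N[S]) ⟩
      ∣ I ∩ N[S] ∣ + ∣ I ─ N[S] ∣  ≤⟨ +-mono-≤ ∣I∩N[S]∣≤∣S∣ ∣I─N[S]∣≤∣X∣ ⟩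
      ∣ S ∣ + ∣ X ∣                ≡⟨ sym (∣p∪q∣≡∣p∣+∣q∣ S X disjoint) ⟩
      ∣ U ∣                        ∎
      where
      open ≤-Reasoning
      ∣I∩N[S]∣≤∣S∣ : ∣ I ∩ N[S] ∣ ≤ ∣ S ∣
      ∣I∩N[S]∣≤∣S∣ = maxS (I ∩ N[S]) (p∩q⊆q I N[S]) (Independent-⊆ (p∩q⊆p I N[S]) indI)
      ∣I─N[S]∣≤∣X∣ : ∣ I ─ N[S] ∣ ≤ ∣ X ∣
      ∣I─N[S]∣≤∣X∣ = ∣P∣≤∣T─N[S]∣ ψS ψT (I─N[S]⊆N[T]─N[S] I⊆N[U]) (Independent-⊆ (p─q⊆p I N[S]) indI)

lemma3p4 : ∀ (n : ℕ) (G : Graph n) (S T : Subset n) →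
    Ψ G S → Ψ G T →
    Ψ G (S ∪ (T ─ N[_] G S)) × Ψ G (T ∪ (S ─ N[_] G T))
lemma3p4 n G S T ψS ψT = S∪[T─N[S]]∈Ψ G ψS ψT , S∪[T─N[S]]∈Ψ G ψT ψS
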